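{- Let $\mathcal{F}\subset 2^{[n]}$ be a family containing no $s$ pairwise disjoint sets, and let $k\ge1$, $t\ge0$ be integers such that $n=ks+t$. Then \[ y_{\mathcal{F}}(k)\ge\left(1+\frac tk\right)\binom{n-1}{k-1}. \]
   Context: $[n]=\{1,\dots,n\}$. For a family $\mathcal{F}\subset 2^{[n]}$, $y_{\mathcal{F}}(k)=\binom nk-|\mathcal{F}^{(k)}|$ is the number of $k$-element subsets of $[n]$ not in $\mathcal{F}$, where $\mathcal{F}^{(k)}$ is the set of $k$-element members of $\mathcal{F}$. -}

module Defs where

open import Data.Nat using (ℕ; zero; suc; _≡ᵇ_)
open import Data.Bool using (Bool; true; false; _∧_; not)
open import Data.Fin using (Fin)
open import Data.Fin.Subset using (Subset; inside; outside; ∣_∣; _∩_; ⊥)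
open import Data.Vec using (_∷_; [])
open import Data.List using (List; []; _∷_; map; _++_; length; filterᵇ)
open import Data.Product using (Σ; _×_)
open import Relation.Binary.PropositionalEquality using (_≡_; _≢_)
open import Relation.Nullary using (¬_)

Family : ℕ → Set
Family n = Subset n → Bool

allSubsets : (n : ℕ) → List (Subset n)
allSubsets zero    = [] ∷ []
allSubsets (suc n) = map (outside ∷_) (allSubsets n) ++ map (inside ∷_) (allSubsets n)

y : {n : ℕ} → Family n → ℕ → ℕ
y {n} 𝓕 k = length (filterᵇ (λ A → (∣ A ∣ ≡ᵇ k) ∧ not (𝓕 A)) (allSubsets n))

HasPairwiseDisjoint : {n : ℕ} → Family n → ℕ → Set
HasPairwiseDisjoint {n} 𝓕 s =
  Σ (Fin s → Subset n) λ A →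
    (∀ i → 𝓕 (A i) ≡ true) ×
    (∀ i j → i ≢ j → A i ≢ A j) ×
    (∀ i j → i ≢ j → A i ∩ A j ≡ ⊥)

-- Katona's circle method. Arrange [n] on a cycle by a permutation σ and look at the n arcs
-- σ{p, p+1, …, p+k−1} (mod n). As n ≥ sk, among more than (s−1)k of these arcs there are s
-- pairwise disjoint ones, so at most (s−1)k arcs lie in 𝓕. Every k-set is the image of a given
-- arc under exactly k!(n−k)! permutations, so summing over all σ gives
-- n·k!(n−k)!·|𝓕⁽ᵏ⁾| ≤ n!·(s−1)k, that is |𝓕⁽ᵏ⁾| ≤ (s−1)·C(n−1,k−1). Hence
-- k·y = k·C(n,k) − k·|𝓕⁽ᵏ⁾| ≥ (n − (s−1)k)·C(n−1,k−1) = (k+t)·C(n−1,k−1).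

module Submission where

open import Defs
open import Data.Nat using (ℕ; zero; suc; _+_; _*_; _∸_; _≤_; _<_; z≤n; s≤s; s≤s⁻¹; _<?_; _<ᵇ_; _≡ᵇ_; _!)
open import Data.Nat.Properties hiding (_≟_)
open import Data.Nat.Combinatorics using (_C_; nCk≡n!/k![n-k]!; k![n∸k]!∣n!; nCk+nC[k+1]≡[n+1]C[k+1])
open import Data.Nat.DivMod using (m/n*n≡m)
open import Data.Nat.ListAction using (sum)
open import Data.Nat.ListAction.Properties using (sum-++)
open import Data.Nat.Solver using (module +-*-Solver)
open import Data.Bool using (Bool; true; false; _∧_; not; if_then_else_; T; _≟_)
open import Data.Bool.Properties using (¬-not)
open import Data.Fin using (Fin; zero; suc; toℕ; fromℕ<)
open import Data.Fin.Properties using (toℕ<n; toℕ-fromℕ<; toℕ-injective; any?)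
open import Data.Fin.Subset using (Subset; inside; outside; ∣_∣; _∩_; ⊥)
open import Data.Fin.Subset.Properties using (∣p∣≤n; ∣⊥∣≡0; ∩-comm; ∩-idem)
open import Data.Vec using (_∷_; []; insertAt; removeAt; lookup; count; tabulate)
open import Data.Vec.Properties using (insertAt-lookup; removeAt-insertAt; ∷-injective)
open import Data.List using ([]; _∷_; map; _++_; length; filterᵇ)
open import Data.List.Properties using (map-++; map-∘)
open import Data.Product using (∃-syntax; _×_; _,_; proj₁; proj₂)
open import Data.Sum using (_⊎_; inj₁; inj₂)
open import Function using (_∘_; id)
open import Relation.Binary.PropositionalEquality
open import Relation.Binary.Definitions using (tri<; tri≈; tri>)
open import Relation.Nullary using (¬_; yes; no; contradiction)
open import Relation.Nullary.Reflects using (ofʸ; ofⁿ)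
open import Algebra.Properties.CommutativeMonoid.Sum +-0-commutativeMonoid
  using (sum-syntax; sum-cong-≗; sum-replicate-zero; ∑-distrib-+; ∑-comm)
open import Algebra.Properties.Semiring.Sum +-*-semiring using (*-distribˡ-sum)
open import Algebra.Properties.CommutativeSemigroup +-commutativeSemigroup
  using (interchange; x∙yz≈y∙xz; xy∙z≈xz∙y)
open import Algebra.Properties.CommutativeSemigroup *-commutativeSemigroup
  using () renaming (x∙yz≈y∙xz to x*[y*z]≡y*[x*z])
open +-*-Solver using (solve; _:*_; _:+_; _:=_; con)

𝟙 : Bool → ℕ
𝟙 true  = 1
𝟙 false = 0

∑-const : ∀ n c → ∑[ i < n ] c ≡ n * c
∑-const zero    c = refl
∑-const (suc n) c = cong (c +_) (∑-const n c)

∑-mono-≤ : ∀ {n} {f g : Fin n → ℕ} → (∀ i → f i ≤ g i) → ∑[ i < n ] f i ≤ ∑[ i < n ] g i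
∑-mono-≤ {zero}          f≤g = z≤n
∑-mono-≤ {suc n} {f} {g} f≤g = +-mono-≤ (f≤g zero) (∑-mono-≤ {f = f ∘ suc} {g ∘ suc} (f≤g ∘ suc))

∑-splitAt : ∀ a b (f : ℕ → ℕ) → ∑[ i < a + b ] f (toℕ i) ≡ ∑[ i < a ] f (toℕ i) + ∑[ i < b ] f (a + toℕ i)
∑-splitAt zero    b f = refl
∑-splitAt (suc a) b f = trans (cong (f 0 +_) (∑-splitAt a b (f ∘ suc))) (sym (+-assoc (f 0) _ _))

∑-combine : ∀ s k (f : ℕ → ℕ) → ∑[ i < s * k ] f (toℕ i) ≡ ∑[ j < s ] ∑[ c < k ] f (toℕ j * k + toℕ c)
∑-combine zero    k f = refl
∑-combine (suc s) k f = begin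
  ∑[ i < k + s * k ] f (toℕ i)
    ≡⟨ ∑-splitAt k (s * k) f ⟩
  ∑[ c < k ] f (toℕ c) + ∑[ i < s * k ] f (k + toℕ i)
    ≡⟨ cong (∑[ c < k ] f (toℕ c) +_) (∑-combine s k (λ i → f (k + i))) ⟩
  ∑[ c < k ] f (toℕ c) + ∑[ j < s ] ∑[ c < k ] f (k + (toℕ j * k + toℕ c))
    ≡⟨ cong (∑[ c < k ] f (toℕ c) +_)
         (sum-cong-≗ {s} λ j → sum-cong-≗ {k} λ c → cong f (+-assoc k (toℕ j * k) (toℕ c))) ⟨
  ∑[ c < k ] f (toℕ c) + ∑[ j < s ] ∑[ c < k ] f (k + toℕ j * k + toℕ c)
    ∎
  where open ≡-Reasoning

∑-𝟙≤ : ∀ n (g : Fin n → Bool) → ∑[ i < n ] 𝟙 (g i) ≤ n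
∑-𝟙≤ zero    g = z≤n
∑-𝟙≤ (suc n) g with g zero
... | true  = s≤s (∑-𝟙≤ n (g ∘ suc))
... | false = m≤n⇒m≤1+n (∑-𝟙≤ n (g ∘ suc))

∑-𝟙-full : ∀ n (g : Fin n → Bool) → n ≤ ∑[ i < n ] 𝟙 (g i) → ∀ i → g i ≡ true
∑-𝟙-full (suc n) g n≤∑ i with g zero in g0≡
∑-𝟙-full (suc n) g n≤∑ zero    | true  = g0≡
∑-𝟙-full (suc n) g n≤∑ (suc i) | true  = ∑-𝟙-full n (g ∘ suc) (s≤s⁻¹ n≤∑) i
∑-𝟙-full (suc n) g n≤∑ i       | false = contradiction n≤∑ (<⇒≱ (s≤s (∑-𝟙≤ n (g ∘ suc))))

pigeonhole : ∀ n a (f : Fin n → ℕ) → n * a < ∑[ i < n ] f i → ∃[ i ] a < f i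
pigeonhole (suc n) a f na<∑ with a <? f zero
... | yes a<f0 = zero , a<f0
... | no  a≮f0 with pigeonhole n a (f ∘ suc) (+-cancelˡ-< a _ _ na<a+∑)
  where na<a+∑ = <-≤-trans na<∑ (+-monoˡ-≤ _ (≮⇒≥ a≮f0))
...   | i , a<fi = suc i , a<fi

-- Sums over the subsets of [n]

∑ˢ : (n : ℕ) → (Subset n → ℕ) → ℕ
∑ˢ zero    g = g []
∑ˢ (suc n) g = ∑ˢ n (g ∘ (outside ∷_)) + ∑ˢ n (g ∘ (inside ∷_))

∑ˢ-cong : ∀ n {f g : Subset n → ℕ} → (∀ A → f A ≡ g A) → ∑ˢ n f ≡ ∑ˢ n g
∑ˢ-cong zero    f≡g = f≡g []
∑ˢ-cong (suc n) f≡g = cong₂ _+_ (∑ˢ-cong n (f≡g ∘ (outside ∷_))) (∑ˢ-cong n (f≡g ∘ (inside ∷_)))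

∑ˢ-distrib-+ : ∀ n (f g : Subset n → ℕ) → ∑ˢ n (λ A → f A + g A) ≡ ∑ˢ n f + ∑ˢ n g
∑ˢ-distrib-+ zero    f g = refl
∑ˢ-distrib-+ (suc n) f g = trans
  (cong₂ _+_ (∑ˢ-distrib-+ n (f ∘ (outside ∷_)) (g ∘ (outside ∷_)))
             (∑ˢ-distrib-+ n (f ∘ (inside ∷_)) (g ∘ (inside ∷_))))
  (interchange (∑ˢ n (f ∘ (outside ∷_))) _ _ _)

∑ˢ-distribˡ-* : ∀ n c (g : Subset n → ℕ) → ∑ˢ n (λ A → c * g A) ≡ c * ∑ˢ n g
∑ˢ-distribˡ-* zero    c g = refl
∑ˢ-distribˡ-* (suc n) c g = trans
  (cong₂ _+_ (∑ˢ-distribˡ-* n c (g ∘ (outside ∷_))) (∑ˢ-distribˡ-* n c (g ∘ (inside ∷_))))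
  (sym (*-distribˡ-+ c _ _))

sum-map-allSubsets : ∀ n (g : Subset n → ℕ) → sum (map g (allSubsets n)) ≡ ∑ˢ n g
sum-map-allSubsets zero    g = +-identityʳ (g [])
sum-map-allSubsets (suc n) g = begin
  sum (map g (map (outside ∷_) S ++ map (inside ∷_) S))
    ≡⟨ cong sum (map-++ g (map (outside ∷_) S) _) ⟩
  sum (map g (map (outside ∷_) S) ++ map g (map (inside ∷_) S))
    ≡⟨ sum-++ (map g (map (outside ∷_) S)) _ ⟩
  sum (map g (map (outside ∷_) S)) + sum (map g (map (inside ∷_) S))
    ≡⟨ sym (cong₂ _+_ (cong sum (map-∘ S)) (cong sum (map-∘ S))) ⟩
  sum (map (g ∘ (outside ∷_)) S) + sum (map (g ∘ (inside ∷_)) S)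
    ≡⟨ cong₂ _+_ (sum-map-allSubsets n _) (sum-map-allSubsets n _) ⟩
  ∑ˢ (suc n) g ∎
  where
  open ≡-Reasoning
  S = allSubsets n

length-filterᵇ : ∀ {A : Set} (p : A → Bool) xs → length (filterᵇ p xs) ≡ sum (map (𝟙 ∘ p) xs)
length-filterᵇ p []       = refl
length-filterᵇ p (x ∷ xs) with p x
... | true  = cong suc (length-filterᵇ p xs)
... | false = length-filterᵇ p xs

length-filterᵇ-allSubsets : ∀ n (p : Subset n → Bool) → length (filterᵇ p (allSubsets n)) ≡ ∑ˢ n (𝟙 ∘ p)
length-filterᵇ-allSubsets n p = trans (length-filterᵇ p (allSubsets n)) (sum-map-allSubsets n (𝟙 ∘ p))

∣x∷A∣ : ∀ {n} x (A : Subset n) → ∣ x ∷ A ∣ ≡ 𝟙 x + ∣ A ∣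
∣x∷A∣ true  A = refl
∣x∷A∣ false A = refl

∣insertAt∣ : ∀ {n} (A : Subset n) v b → ∣ insertAt A v b ∣ ≡ 𝟙 b + ∣ A ∣
∣insertAt∣ A       zero    b = ∣x∷A∣ b A
∣insertAt∣ (x ∷ A) (suc v) b = begin
  ∣ x ∷ insertAt A v b ∣   ≡⟨ ∣x∷A∣ x (insertAt A v b) ⟩
  𝟙 x + ∣ insertAt A v b ∣ ≡⟨ cong (𝟙 x +_) (∣insertAt∣ A v b) ⟩
  𝟙 x + (𝟙 b + ∣ A ∣)     ≡⟨ x∙yz≈y∙xz (𝟙 x) (𝟙 b) ∣ A ∣ ⟩
  𝟙 b + (𝟙 x + ∣ A ∣)     ≡⟨ cong (𝟙 b +_) (∣x∷A∣ x A) ⟨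
  𝟙 b + ∣ x ∷ A ∣         ∎
  where open ≡-Reasoning

∑-insertAt : ∀ n b (h : Subset (suc n) → ℕ) →
  ∑[ v < suc n ] ∑ˢ n (λ B → h (insertAt B v b)) ≡ ∑ˢ (suc n) (λ A → count (_≟ b) A * h A)
∑-insertAt zero    true  h = refl
∑-insertAt zero    false h = sym (+-identityʳ (h (outside ∷ []) + 0))
∑-insertAt (suc n) b     h = begin
  Z b + ∑[ v < suc n ] (O v + I v)                ≡⟨ cong (Z b +_) (∑-distrib-+ O I) ⟩
  Z b + (∑[ v < suc n ] O v + ∑[ v < suc n ] I v) ≡⟨ cong (Z b +_) (cong₂ _+_ (∑-insertAt n b (h ∘ (outside ∷_)))
                                                                               (∑-insertAt n b (h ∘ (inside ∷_)))) ⟩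
  Z b + (X b + Y b)                               ≡⟨ regroup b ⟩
  ∑ˢ (suc (suc n)) (λ A → count (_≟ b) A * h A)   ∎
  where
  open ≡-Reasoning
  O I : Fin (suc n) → ℕ
  O v = ∑ˢ n (λ B → h (outside ∷ insertAt B v b))
  I v = ∑ˢ n (λ B → h (inside ∷ insertAt B v b))
  Z X Y : Bool → ℕ
  Z c = ∑ˢ (suc n) (λ B → h (c ∷ B))
  X c = ∑ˢ (suc n) (λ A → count (_≟ c) A * h (outside ∷ A))
  Y c = ∑ˢ (suc n) (λ A → count (_≟ c) A * h (inside ∷ A))
  regroup : ∀ c → Z c + (X c + Y c) ≡ ∑ˢ (suc (suc n)) (λ A → count (_≟ c) A * h A)
  regroup true  = trans (x∙yz≈y∙xz (Z true) (X true) (Y true)) (cong (X true +_)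
    (sym (∑ˢ-distrib-+ (suc n) (h ∘ (inside ∷_)) (λ A → count (_≟ true) A * h (inside ∷ A)))))
  regroup false = trans (sym (+-assoc (Z false) (X false) (Y false))) (cong (_+ Y false)
    (sym (∑ˢ-distrib-+ (suc n) (h ∘ (outside ∷_)) (λ A → count (_≟ false) A * h (outside ∷ A)))))

onLayer : ∀ {n} → ℕ → (Subset n → ℕ) → Subset n → ℕ
onLayer k g A = if ∣ A ∣ ≡ᵇ k then g A else 0

onLayer-insertAt : ∀ {n} (B : Subset n) v b k (g : Subset (suc n) → ℕ) →
                  onLayer k (λ B → g (insertAt B v b)) B ≡ onLayer (𝟙 b + k) g (insertAt B v b)
onLayer-insertAt B v true  k g rewrite ∣insertAt∣ B v true  = refl
onLayer-insertAt B v false k g rewrite ∣insertAt∣ B v false = refl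

onLayer-scale : ∀ {n} k (g w : Subset n → ℕ) c → (∀ A → ∣ A ∣ ≡ k → w A ≡ c) →
               ∀ A → w A * onLayer k g A ≡ c * onLayer k g A
onLayer-scale k g w c w≡c A with ∣ A ∣ ≡ᵇ k in ∣A∣≡ᵇk
... | true  = cong (_* g A) (w≡c A (≡ᵇ⇒≡ ∣ A ∣ k (subst T (sym ∣A∣≡ᵇk) _)))
... | false = trans (*-zeroʳ (w A)) (sym (*-zeroʳ c))

count-outside : ∀ {n} (A : Subset n) → count (_≟ outside) A ≡ n ∸ ∣ A ∣
count-outside []           = refl
count-outside (inside ∷ A)  = count-outside A
count-outside (outside ∷ A) = trans (cong suc (count-outside A)) (sym (+-∸-assoc 1 (∣p∣≤n A)))

∑-insertAt-onLayer : ∀ n b k (g : Subset (suc n) → ℕ) →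
  ∑[ v < suc n ] ∑ˢ n (onLayer k (λ B → g (insertAt B v b)))
    ≡ (if b then suc k else suc n ∸ k) * ∑ˢ (suc n) (onLayer (𝟙 b + k) g)
∑-insertAt-onLayer n b k g = begin
  ∑[ v < suc n ] ∑ˢ n (onLayer k (λ B → g (insertAt B v b)))
    ≡⟨ sum-cong-≗ {suc n} (λ v → ∑ˢ-cong n (λ B → onLayer-insertAt B v b k g)) ⟩
  ∑[ v < suc n ] ∑ˢ n (λ B → onLayer (𝟙 b + k) g (insertAt B v b))
    ≡⟨ ∑-insertAt n b (onLayer (𝟙 b + k) g) ⟩
  ∑ˢ (suc n) (λ A → count (_≟ b) A * onLayer (𝟙 b + k) g A)
    ≡⟨ ∑ˢ-cong (suc n) (onLayer-scale (𝟙 b + k) g (count (_≟ b)) (multiplicity b) (count≡multiplicity b)) ⟩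
  ∑ˢ (suc n) (λ A → multiplicity b * onLayer (𝟙 b + k) g A)
    ≡⟨ ∑ˢ-distribˡ-* (suc n) (multiplicity b) (onLayer (𝟙 b + k) g) ⟩
  multiplicity b * ∑ˢ (suc n) (onLayer (𝟙 b + k) g)
    ∎
  where
  open ≡-Reasoning
  multiplicity : Bool → ℕ
  multiplicity c = if c then suc k else suc n ∸ k
  count≡multiplicity : ∀ b A → ∣ A ∣ ≡ 𝟙 b + k → count (_≟ b) A ≡ multiplicity b
  count≡multiplicity true  A ∣A∣≡ = ∣A∣≡
  count≡multiplicity false A ∣A∣≡ = trans (count-outside A) (cong (suc n ∸_) ∣A∣≡)

∑ˢ-onLayer-1 : ∀ n k → ∑ˢ n (onLayer k (λ _ → 1)) ≡ n C k
∑ˢ-onLayer-1 zero    zero    = refl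
∑ˢ-onLayer-1 zero    (suc k) = refl
∑ˢ-onLayer-1 (suc n) zero    = cong₂ _+_ (∑ˢ-onLayer-1 n zero) (∑ˢ-distribˡ-* n 0 (λ _ → 0))
∑ˢ-onLayer-1 (suc n) (suc k) = trans (cong₂ _+_ (∑ˢ-onLayer-1 n (suc k)) (∑ˢ-onLayer-1 n k))
  (trans (+-comm (n C suc k) (n C k)) (nCk+nC[k+1]≡[n+1]C[k+1] n k))

nCk*k!*[n∸k]!≡n! : ∀ {n k} → k ≤ n → (n C k) * (k ! * (n ∸ k) !) ≡ n !
nCk*k!*[n∸k]!≡n! {n} {k} k≤n =
  trans (cong (_* (k ! * (n ∸ k) !)) (nCk≡n!/k![n-k]! k≤n)) (m/n*n≡m (k![n∸k]!∣n! k≤n))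
  where instance _ = k !* (n ∸ k) !≢0

[k+1]*[n+1]C[k+1]≡[n+1]*nCk : ∀ n k → k ≤ n → suc k * (suc n C suc k) ≡ suc n * (n C k)
[k+1]*[n+1]C[k+1]≡[n+1]*nCk n k k≤n = *-cancelʳ-≡ _ _ (k ! * (n ∸ k) !) {{k !* (n ∸ k) !≢0}} (begin
  suc k * (suc n C suc k) * (k ! * (n ∸ k) !)
    ≡⟨ solve 4 (λ m c a b → m :* c :* (a :* b) := c :* (m :* a :* b)) refl
               (suc k) (suc n C suc k) (k !) ((n ∸ k) !) ⟩
  (suc n C suc k) * (suc k ! * (suc n ∸ suc k) !) ≡⟨ nCk*k!*[n∸k]!≡n! (s≤s k≤n) ⟩
  suc n !                                       ≡⟨ cong (suc n *_) (nCk*k!*[n∸k]!≡n! k≤n) ⟨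
  suc n * ((n C k) * (k ! * (n ∸ k) !))         ≡⟨ *-assoc (suc n) (n C k) _ ⟨
  suc n * (n C k) * (k ! * (n ∸ k) !)           ∎)
  where open ≡-Reasoning

layer-partition : ∀ {n} (F : Family n) k → ∑ˢ n (onLayer k (𝟙 ∘ F)) + y F k ≡ n C k
layer-partition {n} F k = begin
  ∑ˢ n (onLayer k (𝟙 ∘ F)) + y F k
    ≡⟨ cong (∑ˢ n (onLayer k (𝟙 ∘ F)) +_) (length-filterᵇ-allSubsets n _) ⟩
  ∑ˢ n (onLayer k (𝟙 ∘ F)) + ∑ˢ n (λ A → 𝟙 ((∣ A ∣ ≡ᵇ k) ∧ not (F A)))
    ≡⟨ ∑ˢ-distrib-+ n (onLayer k (𝟙 ∘ F)) _ ⟨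
  ∑ˢ n (λ A → onLayer k (𝟙 ∘ F) A + 𝟙 ((∣ A ∣ ≡ᵇ k) ∧ not (F A)))
    ≡⟨ ∑ˢ-cong n (λ A → split (∣ A ∣ ≡ᵇ k) (F A)) ⟩
  ∑ˢ n (onLayer k (λ _ → 1))
    ≡⟨ ∑ˢ-onLayer-1 n k ⟩
  n C k ∎
  where
  open ≡-Reasoning
  split : ∀ a b → (if a then 𝟙 b else 0) + 𝟙 (a ∧ not b) ≡ (if a then 1 else 0)
  split true  true  = refl
  split true  false = refl
  split false b     = refl

-- Sums over the permutations of [n]

SubsetMap : ℕ → Set
SubsetMap n = Subset n → Subset n

extend : ∀ {n} → Fin (suc n) → SubsetMap n → SubsetMap (suc n)
extend v T (b ∷ A) = insertAt (T A) v b

-- ∑ᵖ n φ sums φ over the n! maps A ↦ σ[A], σ a permutation of [n]: a permutation of [n+1] is one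
-- of [n] together with the position v at which the extra point is inserted.
∑ᵖ : (n : ℕ) → (SubsetMap n → ℕ) → ℕ
∑ᵖ zero    φ = φ id
∑ᵖ (suc n) φ = ∑[ v < suc n ] ∑ᵖ n (φ ∘ extend v)

∑ᵖ-∑ : ∀ n m (φ : Fin m → SubsetMap n → ℕ) → ∑ᵖ n (λ T → ∑[ i < m ] φ i T) ≡ ∑[ i < m ] ∑ᵖ n (φ i)
∑ᵖ-∑ zero    m φ = refl
∑ᵖ-∑ (suc n) m φ = trans (sum-cong-≗ {suc n} (λ v → ∑ᵖ-∑ n m (λ i → φ i ∘ extend v)))
                         (∑-comm (λ v i → ∑ᵖ n (φ i ∘ extend v)))

∑ᵖ-image : ∀ n (J : Subset n) (g : Subset n → ℕ) →
           ∑ᵖ n (λ T → g (T J)) ≡ (∣ J ∣ ! * (n ∸ ∣ J ∣) !) * ∑ˢ n (onLayer ∣ J ∣ g)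
∑ᵖ-image zero    []      g = sym (+-identityʳ (g []))
∑ᵖ-image (suc n) (b ∷ J) g rewrite ∣x∷A∣ b J = begin
  ∑[ v < suc n ] ∑ᵖ n (λ T → g (insertAt (T J) v b))
    ≡⟨ sum-cong-≗ {suc n} (λ v → ∑ᵖ-image n J (λ B → g (insertAt B v b))) ⟩
  ∑[ v < suc n ] (D * ∑ˢ n (onLayer k (λ B → g (insertAt B v b))))
    ≡⟨ *-distribˡ-sum D (λ v → ∑ˢ n (onLayer k (λ B → g (insertAt B v b)))) ⟨
  D * ∑[ v < suc n ] ∑ˢ n (onLayer k (λ B → g (insertAt B v b)))
    ≡⟨ cong (D *_) (∑-insertAt-onLayer n b k g) ⟩
  D * ((if b then suc k else suc n ∸ k) * ∑ˢ (suc n) (onLayer (𝟙 b + k) g))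
    ≡⟨ factorials b ⟩
  ((𝟙 b + k) ! * (suc n ∸ (𝟙 b + k)) !) * ∑ˢ (suc n) (onLayer (𝟙 b + k) g)
    ∎
  where
  open ≡-Reasoning
  k = ∣ J ∣
  D = k ! * (n ∸ k) !
  factorials : ∀ b {S} →
    D * ((if b then suc k else suc n ∸ k) * S) ≡ ((𝟙 b + k) ! * (suc n ∸ (𝟙 b + k)) !) * S
  factorials true  {S} =
    solve 4 (λ a b m x → (a :* b) :* (m :* x) := ((m :* a) :* b) :* x) refl (k !) ((n ∸ k) !) (suc k) S
  factorials false {S} rewrite +-∸-assoc 1 (∣p∣≤n J) =
    solve 4 (λ a b m x → (a :* b) :* (m :* x) := (a :* (m :* b)) :* x) refl (k !) ((n ∸ k) !) (suc (n ∸ k)) S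

record IsDisjointnessEmbedding {n} (T : SubsetMap n) : Set where
  field
    injective : ∀ {A B} → T A ≡ T B → A ≡ B
    disjoint  : ∀ {A B} → A ∩ B ≡ ⊥ → T A ∩ T B ≡ ⊥

insertAt-injective : ∀ {n} {A B : Subset n} v {a b} → insertAt A v a ≡ insertAt B v b → a ≡ b × A ≡ B
insertAt-injective {A = A} {B} v {a} {b} eq =
  trans (sym (insertAt-lookup A v a)) (trans (cong (λ X → lookup X v) eq) (insertAt-lookup B v b)) ,
  trans (sym (removeAt-insertAt A v a)) (trans (cong (λ X → removeAt X v) eq) (removeAt-insertAt B v b))

insertAt-∩ : ∀ {n} (A B : Subset n) v a b → insertAt A v a ∩ insertAt B v b ≡ insertAt (A ∩ B) v (a ∧ b)
insertAt-∩ A       B       zero    a b = refl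
insertAt-∩ (x ∷ A) (y ∷ B) (suc v) a b = cong ((x ∧ y) ∷_) (insertAt-∩ A B v a b)

insertAt-⊥ : ∀ {n} (v : Fin (suc n)) → insertAt ⊥ v outside ≡ ⊥
insertAt-⊥ zero              = refl
insertAt-⊥ {suc n} (suc v)   = cong (outside ∷_) (insertAt-⊥ v)

id-isDisjointnessEmbedding : ∀ {n} → IsDisjointnessEmbedding {n} id
id-isDisjointnessEmbedding = record { injective = id ; disjoint = id }

extend-isDisjointnessEmbedding : ∀ {n} v {T : SubsetMap n} →
  IsDisjointnessEmbedding T → IsDisjointnessEmbedding (extend v T)
extend-isDisjointnessEmbedding v {T} isEmb = record { injective = injective′ ; disjoint = disjoint′ }
  where
  open IsDisjointnessEmbedding isEmb
  injective′ : ∀ {A B} → extend v T A ≡ extend v T B → A ≡ B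
  injective′ {a ∷ A} {b ∷ B} eq with insertAt-injective v eq
  ... | a≡b , TA≡TB = cong₂ _∷_ a≡b (injective TA≡TB)
  disjoint′ : ∀ {A B} → A ∩ B ≡ ⊥ → extend v T A ∩ extend v T B ≡ ⊥
  disjoint′ {a ∷ A} {b ∷ B} A∩B≡⊥ with ∷-injective A∩B≡⊥
  ... | a∧b≡false , A∩B≡⊥′ = begin
    insertAt (T A) v a ∩ insertAt (T B) v b ≡⟨ insertAt-∩ (T A) (T B) v a b ⟩
    insertAt (T A ∩ T B) v (a ∧ b)          ≡⟨ cong₂ (λ X c → insertAt X v c) (disjoint A∩B≡⊥′) a∧b≡false ⟩
    insertAt ⊥ v outside                    ≡⟨ insertAt-⊥ v ⟩
    ⊥                                       ∎
    where open ≡-Reasoning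

∑ᵖ-≤ : ∀ n (φ : SubsetMap n → ℕ) c → (∀ T → IsDisjointnessEmbedding T → φ T ≤ c) → ∑ᵖ n φ ≤ n ! * c
∑ᵖ-≤ zero    φ c φ≤c = subst (φ id ≤_) (sym (+-identityʳ c)) (φ≤c id id-isDisjointnessEmbedding)
∑ᵖ-≤ (suc n) φ c φ≤c = begin
  ∑[ v < suc n ] ∑ᵖ n (φ ∘ extend v)
    ≤⟨ ∑-mono-≤ (λ v → ∑ᵖ-≤ n (φ ∘ extend v) c (λ T → φ≤c (extend v T) ∘ extend-isDisjointnessEmbedding v)) ⟩
  ∑[ v < suc n ] (n ! * c)  ≡⟨ ∑-const (suc n) (n ! * c) ⟩
  suc n * (n ! * c)         ≡⟨ *-assoc (suc n) (n !) c ⟨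
  suc n ! * c               ∎
  where open ≤-Reasoning

-- Arcs of the n-cycle

-- arc n k p = {p, p+1, …, p+k−1} taken mod n (for p < n).
cyclicOffset : ℕ → ℕ → ℕ → ℕ
cyclicOffset n p x = if x <ᵇ p then (n ∸ p) + x else x ∸ p

arc : (n k p : ℕ) → Subset n
arc n k p = tabulate (λ x → cyclicOffset n p (toℕ x) <ᵇ k)

cyclicOffset-< : ∀ {n p x} → x < p → cyclicOffset n p x ≡ (n ∸ p) + x
cyclicOffset-< {n} {p} {x} x<p with x <ᵇ p | <ᵇ-reflects-< x p
... | true  | _       = refl
... | false | ofⁿ x≮p = contradiction x<p x≮p

cyclicOffset-≥ : ∀ {n p x} → p ≤ x → cyclicOffset n p x ≡ x ∸ p
cyclicOffset-≥ {n} {p} {x} p≤x with x <ᵇ p | <ᵇ-reflects-< x p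
... | true  | ofʸ x<p = contradiction p≤x (<⇒≱ x<p)
... | false | _       = refl

∣tabulate∣ : ∀ {n} (f : Fin n → Bool) → ∣ tabulate f ∣ ≡ ∑[ i < n ] 𝟙 (f i)
∣tabulate∣ {zero}  f = refl
∣tabulate∣ {suc n} f =
  trans (∣x∷A∣ (f zero) (tabulate (f ∘ suc))) (cong (𝟙 (f zero) +_) (∣tabulate∣ (f ∘ suc)))

∑-𝟙-<ᵇ : ∀ {n k} → k ≤ n → ∑[ i < n ] 𝟙 (toℕ i <ᵇ k) ≡ k
∑-𝟙-<ᵇ {n}     {zero}  _       = sum-replicate-zero n
∑-𝟙-<ᵇ {suc n} {suc k} (s≤s k≤n) = cong suc (∑-𝟙-<ᵇ k≤n)

∣arc∣ : ∀ {n k p} → p ≤ n → k ≤ n → ∣ arc n k p ∣ ≡ k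
∣arc∣ {n} {k} {p} p≤n k≤n = begin
  ∣ arc n k p ∣
    ≡⟨ ∣tabulate∣ {n} (λ x → cyclicOffset n p (toℕ x) <ᵇ k) ⟩
  ∑[ x < n ] g (toℕ x)
    ≡⟨ cong (λ m → ∑[ x < m ] g (toℕ x)) (m+[n∸m]≡n p≤n) ⟨
  ∑[ x < p + q ] g (toℕ x)
    ≡⟨ ∑-splitAt p q g ⟩
  ∑[ x < p ] g (toℕ x) + ∑[ x < q ] g (p + toℕ x)
    ≡⟨ cong₂ _+_ (sum-cong-≗ {p} before) (sum-cong-≗ {q} after) ⟩
  ∑[ x < p ] h (q + toℕ x) + ∑[ x < q ] h (toℕ x)
    ≡⟨ +-comm (∑[ x < p ] h (q + toℕ x)) _ ⟩
  ∑[ x < q ] h (toℕ x) + ∑[ x < p ] h (q + toℕ x)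
    ≡⟨ ∑-splitAt q p h ⟨
  ∑[ x < q + p ] h (toℕ x)
    ≡⟨ cong (λ m → ∑[ x < m ] h (toℕ x)) (m∸n+n≡m p≤n) ⟩
  ∑[ x < n ] h (toℕ x)
    ≡⟨ ∑-𝟙-<ᵇ k≤n ⟩
  k ∎
  where
  open ≡-Reasoning
  q = n ∸ p
  g h : ℕ → ℕ
  g x = 𝟙 (cyclicOffset n p x <ᵇ k)
  h x = 𝟙 (x <ᵇ k)
  before : ∀ (x : Fin p) → g (toℕ x) ≡ h (q + toℕ x)
  before x = cong h (cyclicOffset-< (toℕ<n x))
  after : ∀ (x : Fin q) → g (p + toℕ x) ≡ h (toℕ x)
  after x = cong h (trans (cyclicOffset-≥ (m≤m+n p (toℕ x))) (m+n∸m≡n p (toℕ x)))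

∈arc : ∀ {n k p x} → p ≤ n → cyclicOffset n p x < k → (x < p × x + n < p + k) ⊎ (p ≤ x × x < p + k)
∈arc {n} {k} {p} {x} p≤n offset<k with x <? p
... | yes x<p = inj₁ (x<p , (begin-strict
  x + n             ≡⟨ +-comm x n ⟩
  n + x             ≡⟨ cong (_+ x) (m+[n∸m]≡n p≤n) ⟨
  p + (n ∸ p) + x   ≡⟨ +-assoc p (n ∸ p) x ⟩
  p + ((n ∸ p) + x) <⟨ +-monoʳ-< p (subst (_< k) (cyclicOffset-< x<p) offset<k) ⟩
  p + k             ∎))
  where open ≤-Reasoning
... | no x≮p = inj₂ (p≤x , (begin-strict
  x           ≡⟨ m+[n∸m]≡n p≤x ⟨
  p + (x ∸ p) <⟨ +-monoʳ-< p (subst (_< k) (cyclicOffset-≥ p≤x) offset<k) ⟩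
  p + k       ∎))
  where
  open ≤-Reasoning
  p≤x = ≮⇒≥ x≮p

tabulate-disjoint : ∀ {n} (f g : Fin n → Bool) → (∀ i → f i ∧ g i ≡ false) → tabulate f ∩ tabulate g ≡ ⊥
tabulate-disjoint {zero}  f g f∧g≡false = refl
tabulate-disjoint {suc n} f g f∧g≡false =
  cong₂ _∷_ (f∧g≡false zero) (tabulate-disjoint (f ∘ suc) (g ∘ suc) (f∧g≡false ∘ suc))

arc-disjoint : ∀ {n k p q} → p + k ≤ q → q + k ≤ p + n → q < n → arc n k p ∩ arc n k q ≡ ⊥
arc-disjoint {n} {k} {p} {q} p+k≤q q+k≤p+n q<n = tabulate-disjoint _ _ (notBoth ∘ toℕ)
  where
  q≤n = <⇒≤ q<n
  p≤n = ≤-trans (m≤m+n p k) (≤-trans p+k≤q q≤n)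
  apart : ∀ {x} → ¬ (((x < p × x + n < p + k) ⊎ (p ≤ x × x < p + k)) ×
                     ((x < q × x + n < q + k) ⊎ (q ≤ x × x < q + k)))
  apart {x} (inj₁ (_ , x+n<p+k) , _)                  = <⇒≱ (<-≤-trans x+n<p+k (≤-trans p+k≤q q≤n)) (m≤n+m n x)
  apart {x} (inj₂ (p≤x , _)     , inj₁ (_ , x+n<q+k)) = <⇒≱ (+-cancelʳ-< n x p (<-≤-trans x+n<q+k q+k≤p+n)) p≤x
  apart {x} (inj₂ (_ , x<p+k)   , inj₂ (q≤x , _))     = <⇒≱ (<-≤-trans x<p+k p+k≤q) q≤x
  notBoth : ∀ x → (cyclicOffset n p x <ᵇ k) ∧ (cyclicOffset n q x <ᵇ k) ≡ false
  notBoth x with cyclicOffset n p x <ᵇ k | <ᵇ-reflects-< (cyclicOffset n p x) k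
               | cyclicOffset n q x <ᵇ k | <ᵇ-reflects-< (cyclicOffset n q x) k
  ... | false | _       | _     | _       = refl
  ... | true  | _       | false | _       = refl
  ... | true  | ofʸ inP | true  | ofʸ inQ = contradiction (∈arc p≤n inP , ∈arc q≤n inQ) apart

-- Starting points, all in P, of s pairwise disjoint arcs of length k on the n-cycle.
record Separated (s k n : ℕ) (P : ℕ → Bool) : Set where
  field
    point     : Fin s → ℕ
    point<n   : ∀ j → point j < n
    satisfies : ∀ j → P (point j) ≡ true
    gap       : ∀ {i j} → toℕ i < toℕ j → point i + k ≤ point j × point j + k ≤ point i + n

blockEnd≤n : ∀ {s k n} (j : Fin s) → s * k ≤ n → toℕ j * k + k ≤ n
blockEnd≤n {s} {k} {n} j sk≤n = begin
  toℕ j * k + k   ≡⟨ +-comm (toℕ j * k) k ⟩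
  suc (toℕ j) * k ≤⟨ *-monoˡ-≤ k (toℕ<n j) ⟩
  s * k           ≤⟨ sk≤n ⟩
  n               ∎
  where open ≤-Reasoning

blockPoint<n : ∀ {s k n c} (j : Fin s) → c < k → s * k ≤ n → toℕ j * k + c < n
blockPoint<n j c<k sk≤n = <-≤-trans (+-monoʳ-< _ c<k) (blockEnd≤n j sk≤n)

blocks-separated : ∀ {s k n c} (P : ℕ → Bool) → c < k → s * k ≤ n →
                   (∀ (j : Fin s) → P (toℕ j * k + c) ≡ true) → Separated s k n P
blocks-separated {s} {k} {n} {c} P c<k sk≤n holds = record
  { point = point ; point<n = λ j → blockPoint<n j c<k sk≤n ; satisfies = holds ; gap = gap }
  where
  point : Fin _ → ℕ
  point j = toℕ j * k + c
  gap : ∀ {i j} → toℕ i < toℕ j → point i + k ≤ point j × point j + k ≤ point i + n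
  gap {i} {j} i<j = (begin
    toℕ i * k + c + k   ≡⟨ xy∙z≈xz∙y (toℕ i * k) c k ⟩
    toℕ i * k + k + c   ≡⟨ cong (_+ c) (+-comm (toℕ i * k) k) ⟩
    suc (toℕ i) * k + c ≤⟨ +-monoˡ-≤ c (*-monoˡ-≤ k i<j) ⟩
    toℕ j * k + c       ∎) , (begin
    toℕ j * k + c + k   ≡⟨ xy∙z≈xz∙y (toℕ j * k) c k ⟩
    toℕ j * k + k + c   ≤⟨ +-monoˡ-≤ c (blockEnd≤n j sk≤n) ⟩
    n + c               ≡⟨ +-comm n c ⟩
    c + n               ≤⟨ +-monoˡ-≤ n (m≤n+m c (toℕ i * k)) ⟩
    toℕ i * k + c + n   ∎)
    where open ≤-Reasoning

skip : ℕ → ℕ → ℕ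
skip zero    i       = suc i
skip (suc x) zero    = zero
skip (suc x) (suc i) = suc (skip x i)

i≤skip : ∀ x i → i ≤ skip x i
i≤skip zero    i       = n≤1+n i
i≤skip (suc x) zero    = z≤n
i≤skip (suc x) (suc i) = s≤s (i≤skip x i)

skip≤suc : ∀ x i → skip x i ≤ suc i
skip≤suc zero    i       = ≤-refl
skip≤suc (suc x) zero    = z≤n
skip≤suc (suc x) (suc i) = s≤s (skip≤suc x i)

skip-mono-+ : ∀ x {a b} k → a + k ≤ b → skip x a + k ≤ skip x b
skip-mono-+ zero    k a+k≤b = s≤s a+k≤b
skip-mono-+ (suc x) {zero}  {b}     k k≤b         = ≤-trans k≤b (i≤skip (suc x) b)
skip-mono-+ (suc x) {suc a} {suc b} k (s≤s a+k≤b) = s≤s (skip-mono-+ x k a+k≤b)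

∑-skip : ∀ {m} (x : Fin (suc m)) (f : ℕ → ℕ) →
         ∑[ i < suc m ] f (toℕ i) ≡ f (toℕ x) + ∑[ i < m ] f (skip (toℕ x) (toℕ i))
∑-skip         zero    f = refl
∑-skip {suc m} (suc x) f = trans (cong (f 0 +_) (∑-skip x (f ∘ suc)))
  (x∙yz≈y∙xz (f 0) (f (suc (toℕ x))) (∑[ i < m ] f (suc (skip (toℕ x) (toℕ i)))))

skip-separated : ∀ {s k m} x (P : ℕ → Bool) → Separated s k m (P ∘ skip x) → Separated s k (suc m) P
skip-separated {s} {k} {m} x P sep = record
  { point = skip x ∘ point
  ; point<n = λ j → s≤s (≤-trans (skip≤suc x (point j)) (point<n j))
  ; satisfies = satisfies
  ; gap = λ i<j → skip-mono-+ x k (proj₁ (gap i<j)) , far (proj₂ (gap i<j))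
  }
  where
  open Separated sep
  far : ∀ {a b} → b + k ≤ a + m → skip x b + k ≤ skip x a + suc m
  far {a} {b} b+k≤a+m = begin
    skip x b + k  ≤⟨ +-monoˡ-≤ k (skip≤suc x b) ⟩
    suc (b + k)   ≤⟨ s≤s b+k≤a+m ⟩
    suc (a + m)   ≡⟨ +-suc a m ⟨
    a + suc m     ≤⟨ +-monoˡ-≤ (suc m) (i≤skip x a) ⟩
    skip x a + suc m ∎
    where open ≤-Reasoning

count⇒separated-exact : ∀ s′ k (P : ℕ → Bool) →
  s′ * k < ∑[ i < suc s′ * k ] 𝟙 (P (toℕ i)) → Separated (suc s′) k (suc s′ * k) P
count⇒separated-exact s′ k P s′k<∑ =
  blocks-separated P (toℕ<n c) ≤-refl (∑-𝟙-full (suc s′) _ s′<classSize)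
  where
  classSize : Fin k → ℕ
  classSize c = ∑[ j < suc s′ ] 𝟙 (P (toℕ j * k + toℕ c))
  classes : ∑[ i < suc s′ * k ] 𝟙 (P (toℕ i)) ≡ ∑[ c < k ] classSize c
  classes = trans (∑-combine (suc s′) k (𝟙 ∘ P)) (∑-comm {suc s′} {k} (λ j c → 𝟙 (P (toℕ j * k + toℕ c))))
  ks′<∑ : k * s′ < ∑[ c < k ] classSize c
  ks′<∑ = subst₂ _<_ (*-comm s′ k) classes s′k<∑
  c = proj₁ (pigeonhole k s′ classSize ks′<∑)
  s′<classSize = proj₂ (pigeonhole k s′ classSize ks′<∑)

all⇒separated : ∀ {s k n} (P : ℕ → Bool) → 0 < k → s * k ≤ n →
                (∀ (x : Fin n) → P (toℕ x) ≡ true) → Separated s k n P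
all⇒separated P 0<k sk≤n all = blocks-separated P 0<k sk≤n λ j →
  let point<n = blockPoint<n j 0<k sk≤n in subst (λ a → P a ≡ true) (toℕ-fromℕ< point<n) (all (fromℕ< point<n))

-- Induction on d: a point outside P is cut out of the cycle (P ∘ skip x). For n = (s′+1)k the k
-- residue classes mod k are separated, and by pigeonhole one of them lies entirely in P.
count⇒separated : ∀ s′ k → 0 < k → ∀ d {n} → n ≡ suc s′ * k + d → (P : ℕ → Bool) →
                  s′ * k < ∑[ i < n ] 𝟙 (P (toℕ i)) → Separated (suc s′) k n P
count⇒separated s′ k 0<k zero    n≡ P s′k<∑ with trans n≡ (+-identityʳ (suc s′ * k))
... | refl = count⇒separated-exact s′ k P s′k<∑
count⇒separated s′ k 0<k (suc d) n≡ P s′k<∑ with trans n≡ (+-suc (suc s′ * k) d)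
... | refl with any? (λ i → P (toℕ i) ≟ false)
...   | no ¬∃false = all⇒separated P 0<k (m≤n⇒m≤1+n (m≤m+n _ d)) (λ x → ¬-not (¬∃false ∘ (x ,_)))
...   | yes (x , Px≡false) = skip-separated (toℕ x) P
        (count⇒separated s′ k 0<k d refl (P ∘ skip (toℕ x)) (subst (s′ * k <_) drop-x s′k<∑))
  where
  rest = ∑[ i < suc s′ * k + d ] 𝟙 (P (skip (toℕ x) (toℕ i)))
  drop-x : ∑[ i < suc (suc s′ * k + d) ] 𝟙 (P (toℕ i)) ≡ rest
  drop-x = trans (∑-skip x (𝟙 ∘ P)) (cong (_+ rest) (cong 𝟙 Px≡false))

separated-arcs-disjoint : ∀ {s k n P} (sep : Separated s k n P) → let open Separated sep in
  ∀ i j → i ≢ j → arc n k (point i) ∩ arc n k (point j) ≡ ⊥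
separated-arcs-disjoint sep i j i≢j with <-cmp (toℕ i) (toℕ j)
... | tri< i<j _ _ = arc-disjoint (proj₁ (gap i<j)) (proj₂ (gap i<j)) (point<n j)
  where open Separated sep
... | tri≈ _ i≡j _ = contradiction (toℕ-injective i≡j) i≢j
... | tri> _ _ j<i = trans (∩-comm _ _) (arc-disjoint (proj₁ (gap j<i)) (proj₂ (gap j<i)) (point<n i))
  where open Separated sep

-- The circle method

pairwiseDisjoint-image : ∀ {n s} (F : Family n) {T : SubsetMap n} → IsDisjointnessEmbedding T →
  (A : Fin s → Subset n) → (∀ i → A i ≢ ⊥) → (∀ i j → i ≢ j → A i ∩ A j ≡ ⊥) →
  (∀ i → F (T (A i)) ≡ true) → HasPairwiseDisjoint F s
pairwiseDisjoint-image F {T} isEmb A nonempty disjointA inF =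
  T ∘ A , inF , distinct , λ i j → disjoint ∘ disjointA i j
  where
  open IsDisjointnessEmbedding isEmb
  distinct : ∀ i j → i ≢ j → T (A i) ≢ T (A j)
  distinct i j i≢j TAi≡TAj = nonempty i (begin
    A i         ≡⟨ ∩-idem (A i) ⟨
    A i ∩ A i   ≡⟨ cong (A i ∩_) (injective TAi≡TAj) ⟩
    A i ∩ A j   ≡⟨ disjointA i j i≢j ⟩
    ⊥           ∎)
    where open ≡-Reasoning

k≤[1+s]*k+t : ∀ {n} s′ k t → n ≡ suc s′ * k + t → k ≤ n
k≤[1+s]*k+t s′ k t n≡ = ≤-trans (m≤m+n k (s′ * k)) (≤-trans (m≤m+n (suc s′ * k) t) (≤-reflexive (sym n≡)))

module CircleMethod {n s′ k t} (F : Family n) (noDisjoint : ¬ HasPairwiseDisjoint F (suc s′))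
                    (0<k : 0 < k) (n≡ : n ≡ suc s′ * k + t) where

  k≤n : k ≤ n
  k≤n = k≤[1+s]*k+t s′ k t n≡

  arc≢⊥ : ∀ {p} → p < n → arc n k p ≢ ⊥
  arc≢⊥ {p} p<n arc≡⊥ = <⇒≢ 0<k (begin
    0               ≡⟨ ∣⊥∣≡0 n ⟨
    ∣ ⊥ {n = n} ∣   ≡⟨ cong ∣_∣ arc≡⊥ ⟨
    ∣ arc n k p ∣   ≡⟨ ∣arc∣ (<⇒≤ p<n) k≤n ⟩
    k               ∎)
    where open ≡-Reasoning

  arcsInFamily≤ : ∀ T → IsDisjointnessEmbedding T → ∑[ i < n ] 𝟙 (F (T (arc n k (toℕ i)))) ≤ s′ * k
  arcsInFamily≤ T isEmb = ≮⇒≥ λ s′k<∑ →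
    let sep = count⇒separated s′ k 0<k t n≡ (λ p → F (T (arc n k p))) s′k<∑
        open Separated sep
    in noDisjoint (pairwiseDisjoint-image F isEmb (λ j → arc n k (point j)) (arc≢⊥ ∘ point<n)
                    (separated-arcs-disjoint sep) satisfies)

  doubleCount-arcsInFamily : n * ((k ! * (n ∸ k) !) * ∑ˢ n (onLayer k (𝟙 ∘ F))) ≤ n ! * (s′ * k)
  doubleCount-arcsInFamily = begin
    n * (D * f)                                 ≡⟨ ∑-const n (D * f) ⟨
    ∑[ i < n ] (D * f)                          ≡⟨ sum-cong-≗ {n} (λ i → arcImages (toℕ<n i)) ⟨
    ∑[ i < n ] ∑ᵖ n (λ T → inFamily T (toℕ i))  ≡⟨ ∑ᵖ-∑ n n (λ i T → inFamily T (toℕ i)) ⟨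
    ∑ᵖ n (λ T → ∑[ i < n ] inFamily T (toℕ i))  ≤⟨ ∑ᵖ-≤ n _ (s′ * k) arcsInFamily≤ ⟩
    n ! * (s′ * k)                              ∎
    where
    open ≤-Reasoning
    D = k ! * (n ∸ k) !
    f = ∑ˢ n (onLayer k (𝟙 ∘ F))
    inFamily : SubsetMap n → ℕ → ℕ
    inFamily T p = 𝟙 (F (T (arc n k p)))
    arcImages : ∀ {p} → p < n → ∑ᵖ n (λ T → inFamily T p) ≡ D * f
    arcImages {p} p<n = trans (∑ᵖ-image n (arc n k p) (𝟙 ∘ F))
      (cong (λ m → (m ! * (n ∸ m) !) * ∑ˢ n (onLayer m (𝟙 ∘ F))) (∣arc∣ (<⇒≤ p<n) k≤n))

familyLayer≤ : ∀ {n′ s′ k′ t} (F : Family (suc n′)) → ¬ HasPairwiseDisjoint F (suc s′) →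
               suc n′ ≡ suc s′ * suc k′ + t → ∑ˢ (suc n′) (onLayer (suc k′) (𝟙 ∘ F)) ≤ s′ * (n′ C k′)
familyLayer≤ {n′} {s′} {k′} {t} F noDisjoint n≡ = *-cancelˡ-≤ n (*-cancelˡ-≤ D {{k !* (n ∸ k) !≢0}} (begin
  D * (n * f)                ≡⟨ x*[y*z]≡y*[x*z] D n f ⟩
  n * (D * f)                ≤⟨ doubleCount-arcsInFamily ⟩
  n ! * (s′ * k)             ≡⟨ cong (_* (s′ * k)) (nCk*k!*[n∸k]!≡n! k≤n) ⟨
  (n C k) * D * (s′ * k)     ≡⟨ solve 4 (λ c d s m → c :* d :* (s :* m) := d :* (s :* (m :* c))) refl (n C k) D s′ k ⟩
  D * (s′ * (k * (n C k)))   ≡⟨ cong (λ x → D * (s′ * x)) ([k+1]*[n+1]C[k+1]≡[n+1]*nCk n′ k′ (s≤s⁻¹ k≤n)) ⟩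
  D * (s′ * (n * (n′ C k′))) ≡⟨ cong (D *_) (x*[y*z]≡y*[x*z] s′ n (n′ C k′)) ⟩
  D * (n * (s′ * (n′ C k′))) ∎))
  where
  open ≤-Reasoning
  open CircleMethod {k = suc k′} {t} F noDisjoint (s≤s z≤n) n≡
  n = suc n′
  k = suc k′
  D = k ! * (n ∸ k) !
  f = ∑ˢ n (onLayer k (𝟙 ∘ F))

mainTheorem3 : (n s k t : ℕ) (𝓕 : Family n) →
    ¬ HasPairwiseDisjoint 𝓕 s → 1 ≤ k → n ≡ k * s + t →
    (k + t) * ((n ∸ 1) C (k ∸ 1)) ≤ k * y 𝓕 k
mainTheorem3 n        zero     k        t 𝓕 noDisjoint _ _ =
  contradiction ((λ ()) , (λ ()) , (λ ()) , (λ ())) noDisjoint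
mainTheorem3 zero     (suc s′) (suc k′) t 𝓕 _          _ ()
mainTheorem3 (suc n′) (suc s′) (suc k′) t 𝓕 noDisjoint _ n≡ = +-cancelʳ-≤ (k * f) ((k + t) * b) (k * y 𝓕 k) (begin
  (k + t) * b + k * f        ≤⟨ +-monoʳ-≤ ((k + t) * b) (*-monoʳ-≤ k (familyLayer≤ 𝓕 noDisjoint n≡′)) ⟩
  (k + t) * b + k * (s′ * b) ≡⟨ solve 4 (λ k t s b → (k :+ t) :* b :+ k :* (s :* b) := (k :* (con 1 :+ s) :+ t) :* b)
                                        refl k t s′ b ⟩
  (k * suc s′ + t) * b       ≡⟨ cong (_* b) n≡ ⟨
  suc n′ * b                 ≡⟨ [k+1]*[n+1]C[k+1]≡[n+1]*nCk n′ k′ (s≤s⁻¹ (k≤[1+s]*k+t s′ k t n≡′)) ⟨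
  k * (suc n′ C k)           ≡⟨ cong (k *_) (layer-partition 𝓕 k) ⟨
  k * (f + y 𝓕 k)            ≡⟨ *-distribˡ-+ k f (y 𝓕 k) ⟩
  k * f + k * y 𝓕 k          ≡⟨ +-comm (k * f) (k * y 𝓕 k) ⟩
  k * y 𝓕 k + k * f          ∎)
  where
  open ≤-Reasoning
  k = suc k′
  b = n′ C k′
  f = ∑ˢ (suc n′) (onLayer k (𝟙 ∘ 𝓕))
  n≡′ : suc n′ ≡ suc s′ * k + t
  n≡′ = trans n≡ (cong (_+ t) (*-comm k (suc s′)))
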